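{- Let $\pi$ be a permutation of a finite set $X$ acting on $X\times X$ by $(x,y)\pi=(x\pi,y\pi)$, and let $\Gamma=\{(x,y)\pi^i:1\le i\le s\}$ be an orbit of $\langle\pi\rangle$ of length $s$ that is not contained in the diagonal $\{(z,z):z\in X\}$. Then $\Gamma$ is symmetric (i.e. $(u,v)\in\Gamma$ implies $(v,u)\in\Gamma$) if and only if $s$ is even and $\Gamma=\{(z,z\pi^{s/2})\pi^{i}:1\le i\le s\}$ for some $z$ lying in a cycle of $\pi$ of length $s$. -}

module Defs where

open import Data.Nat using (ℕ; zero; suc; _≤_; _<_)
open import Data.Fin using (Fin)
open import Data.Fin.Permutation using (Permutation′; _⟨$⟩ʳ_)
open import Data.Product using (_×_; _,_; ∃-syntax)
open import Relation.Binary.PropositionalEquality using (_≡_; _≢_)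

Pair : ℕ → Set
Pair n = Fin n × Fin n

pow : ∀ {n} → Permutation′ n → ℕ → Fin n → Fin n
pow π zero    z = z
pow π (suc i) z = π ⟨$⟩ʳ (pow π i z)

act : ∀ {n} → Permutation′ n → ℕ → Pair n → Pair n
act π i (x , y) = (pow π i x , pow π i y)

Orbit : ∀ {n} → Permutation′ n → Pair n → ℕ → Pair n → Set
Orbit π p s q = ∃[ i ] (1 ≤ i × i ≤ s × q ≡ act π i p)

IsOrbitLength : ∀ {n} → Permutation′ n → Pair n → ℕ → Set
IsOrbitLength π p s =
  1 ≤ s × act π s p ≡ p × (∀ i → 1 ≤ i → i < s → act π i p ≢ p)

InCycleOfLength : ∀ {n} → Permutation′ n → Fin n → ℕ → Set
InCycleOfLength π z s =
  1 ≤ s × pow π s z ≡ z × (∀ i → 1 ≤ i → i < s → pow π i z ≢ z)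

Symmetric : ∀ {n} → (Pair n → Set) → Set
Symmetric {n} Γ = ∀ (u v : Fin n) → Γ (u , v) → Γ (v , u)

-- If Γ is symmetric, (y , x) = (x , y) π^j for some 1 ≤ j ≤ s, so π^(2j) fixes (x , y).
-- j = s would put x = y and Γ on the diagonal, and since s is the least period, 2j
-- (lying strictly between 0 and 2s) must equal s.  Then y = x π^(s/2) and x lies in
-- a cycle of length s.  Conversely, in the orbit of (z , z π^k) with z π^(2k) = z,
-- swapping the coordinates of (z , z π^k) π^i is the same as applying π^(i+k), and
-- an orbit is closed under π.
module Submission where

open import Defs
open import Data.Nat using (ℕ; zero; suc; _+_; _*_; _∸_; _≤_; _<_; z≤n; s≤s)
open import Data.Nat.Properties
open import Data.Fin using (Fin)
open import Data.Fin.Permutation using (Permutation′; _⟨$⟩ʳ_)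
open import Data.Product using (_×_; _,_; ∃-syntax; proj₁; proj₂)
open import Data.Sum using (inj₁; inj₂)
open import Data.Empty using (⊥-elim)
open import Relation.Binary using (tri<; tri≈; tri>)
open import Relation.Binary.PropositionalEquality
open import Relation.Nullary using (¬_)
open import Function.Bundles using (_⇔_; mk⇔; Equivalence)

Symmetric-resp-⇔ : ∀ {n} {Γ Δ : Pair n → Set} →
                   (∀ q → Γ q ⇔ Δ q) → Symmetric Δ → Symmetric Γ
Symmetric-resp-⇔ Γ⇔Δ symΔ u v uv =
  Equivalence.from (Γ⇔Δ (v , u)) (symΔ u v (Equivalence.to (Γ⇔Δ (u , v)) uv))

module _ {n} (π : Permutation′ n) where

  open ≡-Reasoning

  pow-+ : ∀ i j (z : Fin n) → pow π (i + j) z ≡ pow π i (pow π j z)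
  pow-+ zero    j z = refl
  pow-+ (suc i) j z = cong (π ⟨$⟩ʳ_) (pow-+ i j z)

  pow-comm : ∀ i j (z : Fin n) → pow π i (pow π j z) ≡ pow π j (pow π i z)
  pow-comm i j z = begin
    pow π i (pow π j z)  ≡⟨ pow-+ i j z ⟨
    pow π (i + j) z      ≡⟨ cong (λ t → pow π t z) (+-comm i j) ⟩
    pow π (j + i) z      ≡⟨ pow-+ j i z ⟩
    pow π j (pow π i z)  ∎

  act-+ : ∀ i j (p : Pair n) → act π (i + j) p ≡ act π i (act π j p)
  act-+ i j (x , y) = cong₂ _,_ (pow-+ i j x) (pow-+ i j y)

  act∈Orbit : ∀ {p s} → 1 ≤ s → act π s p ≡ p → ∀ m → Orbit π p s (act π m p)
  act∈Orbit {x , y} 1≤s per zero = _ , 1≤s , ≤-refl , sym per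
  act∈Orbit {p} {s} 1≤s per (suc m) with act∈Orbit 1≤s per m
  ... | i , 1≤i , i≤s , mp≡ip with m≤n⇒m<n∨m≡n i≤s
  ...   | inj₁ i<s = suc i , s≤s z≤n , i<s , (begin
          act π (1 + m) p          ≡⟨ act-+ 1 m p ⟩
          act π 1 (act π m p)      ≡⟨ cong (act π 1) mp≡ip ⟩
          act π 1 (act π i p)      ≡⟨ act-+ 1 i p ⟨
          act π (1 + i) p          ∎)
  ...   | inj₂ refl = 1 , ≤-refl , 1≤s , (begin
          act π (1 + m) p          ≡⟨ act-+ 1 m p ⟩
          act π 1 (act π m p)      ≡⟨ cong (act π 1) (trans mp≡ip per) ⟩
          act π 1 p                ∎)

  diagonal-orbit : ∀ {x y s} → x ≡ y → ∀ u v → Orbit π (x , y) s (u , v) → u ≡ v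
  diagonal-orbit refl u v (_ , _ , _ , uv≡) = trans (cong proj₁ uv≡) (sym (cong proj₂ uv≡))

  period-∸ : ∀ {p s t} → s ≤ t → act π s p ≡ p → act π t p ≡ p → act π (t ∸ s) p ≡ p
  period-∸ {p} {s} {t} s≤t ps≡p pt≡p = begin
    act π (t ∸ s) p            ≡⟨ cong (act π (t ∸ s)) ps≡p ⟨
    act π (t ∸ s) (act π s p)  ≡⟨ act-+ (t ∸ s) s p ⟨
    act π (t ∸ s + s) p        ≡⟨ cong (λ i → act π i p) (m∸n+n≡m s≤t) ⟩
    act π t p                  ≡⟨ pt≡p ⟩
    p                          ∎

  period<2*orbitLength⇒≡ : ∀ {p s t} → IsOrbitLength π p s →
                           act π t p ≡ p → 1 ≤ t → t < s + s → t ≡ s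
  period<2*orbitLength⇒≡ {p} {s} {t} (_ , ps≡p , minimal) pt≡p 1≤t t<2s with <-cmp t s
  ... | tri< t<s _ _ = ⊥-elim (minimal t 1≤t t<s pt≡p)
  ... | tri≈ _ t≡s _ = t≡s
  ... | tri> _ _ s<t = ⊥-elim (minimal (t ∸ s) (m<n⇒0<n∸m s<t) t∸s<s
                                       (period-∸ (<⇒≤ s<t) ps≡p pt≡p))
    where
    t∸s<s : t ∸ s < s
    t∸s<s = subst (t ∸ s <_) (m+n∸n≡m s s) (∸-monoˡ-< t<2s (<⇒≤ s<t))

  swap-twice : ∀ {x y j} → (y , x) ≡ act π j (x , y) → act π (j + j) (x , y) ≡ (x , y)
  swap-twice {x} {y} {j} swap = begin
    act π (j + j) (x , y)        ≡⟨ act-+ j j (x , y) ⟩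
    act π j (act π j (x , y))    ≡⟨ cong (act π j) swap ⟨
    act π j (y , x)              ≡⟨ cong₂ _,_ (cong proj₂ swap) (cong proj₁ swap) ⟨
    (x , y)                      ∎

  symmetric⇒half-turn : ∀ {x y s} → IsOrbitLength π (x , y) s →
    ¬ (∀ u v → Orbit π (x , y) s (u , v) → u ≡ v) →
    Symmetric (Orbit π (x , y) s) → ∃[ j ] (s ≡ j + j × y ≡ pow π j x)
  symmetric⇒half-turn {x} {y} {s} ol@(1≤s , per , _) offDiagonal symmetric
    with symmetric x y (s , 1≤s , ≤-refl , sym per)
  ... | j , 1≤j , j≤s , swap with m≤n⇒m<n∨m≡n j≤s
  ...   | inj₁ j<s = j , sym (period<2*orbitLength⇒≡ ol (swap-twice {j = j} swap)
                                  (≤-trans 1≤j (m≤m+n j j)) (+-mono-< j<s j<s))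
                       , cong proj₁ swap
  ...   | inj₂ refl = ⊥-elim (offDiagonal (diagonal-orbit (trans (sym (cong proj₁ per))
                                                                  (sym (cong proj₁ swap)))))

  cycle-of-first-coordinate : ∀ {x y j s} → y ≡ pow π j x →
                              IsOrbitLength π (x , y) s → InCycleOfLength π x s
  cycle-of-first-coordinate {x} {y} {j} refl (1≤s , per , minimal) =
    1≤s , cong proj₁ per ,
    λ i 1≤i i<s πⁱx≡x → minimal i 1≤i i<s
      (cong₂ _,_ πⁱx≡x (trans (pow-comm i j x) (cong (pow π j) πⁱx≡x)))

  half-turn-symmetric : ∀ {z k s} → s ≡ k + k → pow π s z ≡ z →
                        Symmetric (Orbit π (z , pow π k z) s)
  half-turn-symmetric {z} {k} {s} s≡k+k πˢz≡z u v (i , 1≤i , i≤s , uv≡) =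
    subst (Orbit π (z , pow π k z) s) vu≡ (act∈Orbit (≤-trans 1≤i i≤s) per (i + k))
    where
    per : act π s (z , pow π k z) ≡ (z , pow π k z)
    per = cong₂ _,_ πˢz≡z (trans (pow-comm s k z) (cong (pow π k) πˢz≡z))
    vu≡ : act π (i + k) (z , pow π k z) ≡ (v , u)
    vu≡ = cong₂ _,_
      (trans (pow-+ i k z) (sym (cong proj₂ uv≡)))
      (begin
        pow π (i + k) (pow π k z)  ≡⟨ pow-+ i k (pow π k z) ⟩
        pow π i (pow π k (pow π k z))  ≡⟨ cong (pow π i) (pow-+ k k z) ⟨
        pow π i (pow π (k + k) z)  ≡⟨ cong (λ t → pow π i (pow π t z)) s≡k+k ⟨
        pow π i (pow π s z)        ≡⟨ cong (pow π i) πˢz≡z ⟩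
        pow π i z                  ≡⟨ cong proj₁ uv≡ ⟨
        u                          ∎)

2*k≡k+k : ∀ k → 2 * k ≡ k + k
2*k≡k+k k = cong (k +_) (+-identityʳ k)

lemma7p1 : ∀ {n} (π : Permutation′ n) (x y : Fin n) (s : ℕ)
    → IsOrbitLength π (x , y) s
    → ¬ (∀ (u v : Fin n) → Orbit π (x , y) s (u , v) → u ≡ v)
    → Symmetric (Orbit π (x , y) s)
    ⇔ (∃[ k ] (s ≡ 2 * k × ∃[ z ] (InCycleOfLength π z s
    × (∀ (q : Pair n) → Orbit π (x , y) s q ⇔ Orbit π (z , pow π k z) s q))))
lemma7p1 π x y s ol offDiagonal = mk⇔ forward backward
  where
  forward : Symmetric (Orbit π (x , y) s) →
            ∃[ k ] (s ≡ 2 * k × ∃[ z ] (InCycleOfLength π z s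
              × (∀ q → Orbit π (x , y) s q ⇔ Orbit π (z , pow π k z) s q)))
  forward symmetric with symmetric⇒half-turn π ol offDiagonal symmetric
  ... | k , s≡k+k , y≡ = k , trans s≡k+k (sym (2*k≡k+k k)) , x ,
        cycle-of-first-coordinate π {j = k} y≡ ol ,
        λ q → mk⇔ (subst (λ w → Orbit π (x , w) s q) y≡)
                  (subst (λ w → Orbit π (x , w) s q) (sym y≡))
  backward : ∃[ k ] (s ≡ 2 * k × ∃[ z ] (InCycleOfLength π z s
               × (∀ q → Orbit π (x , y) s q ⇔ Orbit π (z , pow π k z) s q))) →
             Symmetric (Orbit π (x , y) s)
  backward (k , s≡2k , z , (_ , πˢz≡z , _) , Γ⇔) =
    Symmetric-resp-⇔ Γ⇔ (half-turn-symmetric π {k = k} (trans s≡2k (2*k≡k+k k)) πˢz≡z)
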